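{- Let $q$ be a power of a prime $p$, let $z\in\mathbb{F}_q^*$, and assume that $x^2+x-z$ has two distinct roots in $\mathbb{F}_q$. Then, in $\mathbb{F}_q$, \[ \sum_{0\le k\le (q-1)/2}(k+1)\binom{ -k}{k+1} z^k=\frac{2z}{1+4z}. \]
   Context: For an integer $m$ and integer $a\ge 0$, $\binom{m}{a}=m(m-1)\cdots(m-a+1)/a!\in\mathbb{Z}$ (generalized binomial coefficient), regarded as an element of $\mathbb{F}_p\subseteq\mathbb{F}_q$ by reduction modulo $p$. (Note $1+4z\neq 0$ under the hypothesis.) -}

module Defs where

open import Level using (Level; _⊔_)
open import Algebra.Bundles using (CommutativeRing; Semiring)
import Algebra.Definitions.RawSemiring as RS
open import Data.Nat as ℕ using (ℕ; zero; suc; _!)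
open import Data.Nat.Properties using (_!≢0)
open import Data.Integer as ℤ using (ℤ; +_; -[1+_])
open import Data.Fin using (Fin)
open import Data.Product using (Σ; ∃; _×_; _,_)
open import Relation.Nullary using (¬_)
open import Relation.Binary.PropositionalEquality using (_≡_)

fallingℤ : ℤ → ℕ → ℤ
fallingℤ m zero    = + 1
fallingℤ m (suc a) = fallingℤ m a ℤ.* (m ℤ.- + a)

-- generalized binomial coefficient  binom m a = m(m-1)...(m-a+1)/a!  (exact division in ℤ)
binomℤ : ℤ → ℕ → ℤ
binomℤ m a = (fallingℤ m a ℤ./ℕ (a !)) {{a !≢0}}

module _ {c ℓ : Level} (F : CommutativeRing c ℓ) where
  open CommutativeRing F
  open RS (Semiring.rawSemiring semiring) using (_^_) renaming (_×_ to _·ₙ_) public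

  IsField : Set (c ⊔ ℓ)
  IsField = (¬ (0# ≈ 1#)) × (∀ x → ¬ (x ≈ 0#) → ∃ λ y → x * y ≈ 1#)

  HasCardinality : ℕ → Set (c ⊔ ℓ)
  HasCardinality q = Σ (Fin q → Carrier) λ e →
    (∀ x → ∃ λ i → e i ≈ x) × (∀ i j → e i ≈ e j → i ≡ j)

  ι : ℤ → Carrier
  ι (+ n)     = n ·ₙ 1#
  ι -[1+ n ] = - (suc n ·ₙ 1#)

  sumTo : ℕ → (ℕ → Carrier) → Carrier
  sumTo zero    f = f 0
  sumTo (suc n) f = sumTo n f + f (suc n)

{-# OPTIONS --safe #-}
module Submission where

-- Since (k+1)·C(-k,k+1) = (-1)^(k+1)·(k+1)·C(2k,k+1) = (-1)^(k+1)·k·C(2k,k), the sum equals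
-- -Σ_{k≤M} k·C(2k,k)·(-z)^k with M = (q-1)/2. In characteristic 2 every k·C(2k,k) is even and both
-- sides vanish. For odd p, 2M+1 = q ≡ 0, i.e. M ≡ -1/2, and C(2k,k) ≡ (-4)^k·C(M,k) for k ≤ M: both
-- sides satisfy (k+1)·c(k+1) = 2(2k+1)·c(k), which determines c(k+1) unless p | k+1, and in that case
-- Lucas's theorem reduces the congruence to the one for (q/p-1)/2. Hence the sum is
-- -Σ_k k·C(M,k)·(4z)^k = -4Mz·(1+4z)^(M-1) = 2z·(1+4z)^(M-1). Finally 1+4z = (α-β)² for the roots
-- α ≠ β of x²+x-z, so (1+4z)^M = (α-β)^(q-1) = 1 by Fermat, and (1+4z)^(M-1) = 1/(1+4z).

open import Defs hiding (_^_; _·ₙ_)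
open import Algebra.Bundles using (CommutativeRing; Semiring)
open import Data.Nat as ℕ using (ℕ; suc; _≥_)
open import Data.Nat.Primality using (Prime)
open import Data.Product using (∃; ∃₂; _×_; _,_; proj₁; proj₂)
open import Data.Sum using (inj₁; inj₂)
open import Function.Base using (_∘_)
open import Relation.Nullary using (¬_; yes; no)
open import Relation.Binary.PropositionalEquality as ≡ using (_≡_; _≢_)

module Binomial where

  open import Data.Nat.Base using (ℕ; zero; suc; _+_; _*_; _<_; _!)
  open import Data.Nat.Properties
  open import Data.Nat.Combinatorics using (_C_; nCk+nC[k+1]≡[n+1]C[k+1]; nC1≡n; nCk≡nC[n∸k])
  open import Data.Nat.Divisibility using (_∣_; divides; ∣⇒≤)
  open import Data.Nat.Primality using (Prime; euclidsLemma; ¬prime[0])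
  open import Data.Nat.Tactic.RingSolver using (solve-∀)
  open import Data.Empty using (⊥-elim)
  open import Relation.Binary.PropositionalEquality
  open ≡-Reasoning

  pascal : ∀ n k → suc n C suc k ≡ n C k + n C suc k
  pascal n k = sym (nCk+nC[k+1]≡[n+1]C[k+1] n k)

  [1+k]*[1+n]C[1+k]≡[1+n]*nCk : ∀ n k → suc k * (suc n C suc k) ≡ suc n * (n C k)
  [1+k]*[1+n]C[1+k]≡[1+n]*nCk zero    zero    = refl
  [1+k]*[1+n]C[1+k]≡[1+n]*nCk zero    (suc k) = *-zeroʳ (suc (suc k))
  [1+k]*[1+n]C[1+k]≡[1+n]*nCk (suc n) zero    = trans (*-identityˡ _) (trans (nC1≡n (suc (suc n))) (sym (*-identityʳ _)))
  [1+k]*[1+n]C[1+k]≡[1+n]*nCk (suc n) (suc k) = begin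
    suc (suc k) * (suc (suc n) C suc (suc k))
      ≡⟨ cong (suc (suc k) *_) (pascal (suc n) (suc k)) ⟩
    suc (suc k) * (suc n C suc k + suc n C suc (suc k))
      ≡⟨ distribute k (suc n C suc k) (suc n C suc (suc k)) ⟩
    suc n C suc k + (suc k * (suc n C suc k) + suc (suc k) * (suc n C suc (suc k)))
      ≡⟨ cong₂ (λ a b → suc n C suc k + (a + b)) ([1+k]*[1+n]C[1+k]≡[1+n]*nCk n k) ([1+k]*[1+n]C[1+k]≡[1+n]*nCk n (suc k)) ⟩
    suc n C suc k + (suc n * (n C k) + suc n * (n C suc k))
      ≡⟨ cong (λ a → suc n C suc k + a) (sym (*-distribˡ-+ (suc n) (n C k) (n C suc k))) ⟩
    suc n C suc k + suc n * (n C k + n C suc k)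
      ≡⟨ cong (λ a → suc n C suc k + suc n * a) (sym (pascal n k)) ⟩
    suc (suc n) * (suc n C suc k) ∎
    where
    distribute : ∀ k a b → suc (suc k) * (a + b) ≡ a + (suc k * a + suc (suc k) * b)
    distribute = solve-∀

  [1+k]*nC[1+k]+k*nCk≡n*nCk : ∀ n k → suc k * (n C suc k) + k * (n C k) ≡ n * (n C k)
  [1+k]*nC[1+k]+k*nCk≡n*nCk zero    zero    = refl
  [1+k]*nC[1+k]+k*nCk≡n*nCk zero    (suc k) = cong₂ _+_ (*-zeroʳ (suc (suc k))) (*-zeroʳ (suc k))
  [1+k]*nC[1+k]+k*nCk≡n*nCk (suc n) zero    = trans (+-identityʳ _) ([1+k]*[1+n]C[1+k]≡[1+n]*nCk n zero)
  [1+k]*nC[1+k]+k*nCk≡n*nCk (suc n) (suc k) = begin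
    suc (suc k) * (suc n C suc (suc k)) + suc k * (suc n C suc k)
      ≡⟨ cong₂ _+_ ([1+k]*[1+n]C[1+k]≡[1+n]*nCk n (suc k)) ([1+k]*[1+n]C[1+k]≡[1+n]*nCk n k) ⟩
    suc n * (n C suc k) + suc n * (n C k)
      ≡⟨ sym (*-distribˡ-+ (suc n) (n C suc k) (n C k)) ⟩
    suc n * (n C suc k + n C k)
      ≡⟨ cong (suc n *_) (trans (+-comm (n C suc k) (n C k)) (sym (pascal n k))) ⟩
    suc n * (suc n C suc k) ∎

  [1+k]*2kC[1+k]≡k*2kCk : ∀ k → suc k * ((k + k) C suc k) ≡ k * ((k + k) C k)
  [1+k]*2kC[1+k]≡k*2kCk k = +-cancelʳ-≡ _ _ _ (begin
    suc k * ((k + k) C suc k) + k * ((k + k) C k) ≡⟨ [1+k]*nC[1+k]+k*nCk≡n*nCk (k + k) k ⟩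
    (k + k) * ((k + k) C k)                      ≡⟨ *-distribʳ-+ ((k + k) C k) k k ⟩
    k * ((k + k) C k) + k * ((k + k) C k)        ∎)

  [2+2k]C[1+k]≡2*[1+2k]C[1+k] : ∀ k → (suc k + suc k) C suc k ≡ 2 * (suc (k + k) C suc k)
  [2+2k]C[1+k]≡2*[1+2k]C[1+k] k = begin
    (suc k + suc k) C suc k
      ≡⟨ cong (λ n → suc n C suc k) (+-suc k k) ⟩
    suc (suc (k + k)) C suc k
      ≡⟨ pascal (suc (k + k)) k ⟩
    suc (k + k) C k + suc (k + k) C suc k
      ≡⟨ cong (_+ suc (k + k) C suc k) symmetric ⟩
    suc (k + k) C suc k + suc (k + k) C suc k
      ≡⟨ cong (suc (k + k) C suc k +_) (sym (+-identityʳ (suc (k + k) C suc k))) ⟩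
    2 * (suc (k + k) C suc k) ∎
    where
    symmetric : suc (k + k) C k ≡ suc (k + k) C suc k
    symmetric = trans (nCk≡nC[n∸k] (≤-trans (m≤m+n k k) (n≤1+n (k + k))))
                      (cong (suc (k + k) C_) (trans (+-∸-assoc 1 (m≤m+n k k)) (cong suc (m+n∸m≡n k k))))

  [1+k]*[2+2k]C[1+k]≡2*[1+2k]*2kCk : ∀ k → suc k * ((suc k + suc k) C suc k) ≡ 2 * suc (k + k) * ((k + k) C k)
  [1+k]*[2+2k]C[1+k]≡2*[1+2k]*2kCk k = begin
    suc k * ((suc k + suc k) C suc k)        ≡⟨ cong (suc k *_) ([2+2k]C[1+k]≡2*[1+2k]C[1+k] k) ⟩
    suc k * (2 * (suc (k + k) C suc k))      ≡⟨ x*[2*y]≡2*[x*y] (suc k) (suc (k + k) C suc k) ⟩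
    2 * (suc k * (suc (k + k) C suc k))      ≡⟨ cong (2 *_) ([1+k]*[1+n]C[1+k]≡[1+n]*nCk (k + k) k) ⟩
    2 * (suc (k + k) * ((k + k) C k))        ≡⟨ sym (*-assoc 2 (suc (k + k)) _) ⟩
    2 * suc (k + k) * ((k + k) C k)          ∎
    where
    x*[2*y]≡2*[x*y] : ∀ x y → x * (2 * y) ≡ 2 * (x * y)
    x*[2*y]≡2*[x*y] = solve-∀

  rising : ℕ → ℕ → ℕ
  rising k zero    = 1
  rising k (suc j) = rising k j * (k + j)

  rising[1+k]j≡j!*[k+j]Cj : ∀ k j → rising (suc k) j ≡ j ! * ((k + j) C j)
  rising[1+k]j≡j!*[k+j]Cj k zero    = refl
  rising[1+k]j≡j!*[k+j]Cj k (suc j) = begin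
    rising (suc k) j * suc (k + j)             ≡⟨ cong (_* suc (k + j)) (rising[1+k]j≡j!*[k+j]Cj k j) ⟩
    j ! * ((k + j) C j) * suc (k + j)          ≡⟨ *-assoc (j !) ((k + j) C j) (suc (k + j)) ⟩
    j ! * (((k + j) C j) * suc (k + j))        ≡⟨ cong (j ! *_) (*-comm ((k + j) C j) (suc (k + j))) ⟩
    j ! * (suc (k + j) * ((k + j) C j))        ≡⟨ cong (j ! *_) (sym ([1+k]*[1+n]C[1+k]≡[1+n]*nCk (k + j) j)) ⟩
    j ! * (suc j * (suc (k + j) C suc j))      ≡⟨ sym (*-assoc (j !) (suc j) (suc (k + j) C suc j)) ⟩
    j ! * suc j * (suc (k + j) C suc j)        ≡⟨ cong₂ (λ a n → a * (n C suc j)) (*-comm (j !) (suc j)) (sym (+-suc k j)) ⟩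
    suc j ! * ((k + suc j) C suc j)            ∎

  rising-k[1+k]≡[1+k]!*2kC[1+k] : ∀ k → rising k (suc k) ≡ suc k ! * ((k + k) C suc k)
  rising-k[1+k]≡[1+k]!*2kC[1+k] zero     = refl
  rising-k[1+k]≡[1+k]!*2kC[1+k] (suc k) = trans (rising[1+k]j≡j!*[k+j]Cj k (suc (suc k)))
    (cong (λ n → suc (suc k) ! * (n C suc (suc k))) (+-suc k (suc k)))

  p∣pCi : ∀ {p i} → Prime p → 0 < i → i < p → p ∣ p C i
  p∣pCi {zero}   p-prime _ _ = ⊥-elim (¬prime[0] p-prime)
  p∣pCi {suc p} {suc i} p-prime _ i<p
    with euclidsLemma (suc i) (suc p C suc i) p-prime (divides (p C i) (trans ([1+k]*[1+n]C[1+k]≡[1+n]*nCk p i) (*-comm (suc p) (p C i))))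
  ... | inj₁ p∣i   = ⊥-elim (<⇒≱ i<p (∣⇒≤ p∣i))
  ... | inj₂ p∣pCi = p∣pCi


module Arithmetic where

  open import Data.Nat.Base using (zero; suc; _+_; _*_; _∸_; _≤_; _<_)
  open import Data.Nat.Properties
  open import Data.Nat.DivMod using (_/_; m*n/n≡m)
  open import Data.Nat.Divisibility using (divides)
  open import Data.Nat.Primality using (Prime; prime⇒irreducible)
  open import Data.Nat.Tactic.RingSolver using (solve-∀)
  open import Data.Sum using (_⊎_)
  open import Relation.Binary.PropositionalEquality

  a*p≤h*p+r⇒a≤h : ∀ {a h p r} → r < p → a * p ≤ h * p + r → a ≤ h
  a*p≤h*p+r⇒a≤h {a} {h} {p} {r} r<p ap≤hp+r = m<1+n⇒m≤n (*-cancelʳ-< p a (suc h)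
    (≤-<-trans ap≤hp+r (subst (h * p + r <_) (+-comm (h * p) p) (+-monoʳ-< (h * p) r<p))))

  even⊎odd : ∀ n → (∃ λ h → n ≡ h + h) ⊎ (∃ λ h → n ≡ suc (h + h))
  even⊎odd zero    = inj₁ (0 , refl)
  even⊎odd (suc n) with even⊎odd n
  ... | inj₁ (h , n≡2h)   = inj₂ (h , cong suc n≡2h)
  ... | inj₂ (h , n≡1+2h) = inj₁ (suc h , cong suc (trans n≡1+2h (sym (+-suc h h))))

  prime⇒≡2⊎odd : ∀ {p} → Prime p → p ≡ 2 ⊎ ∃ λ r → p ≡ suc (r + r)
  prime⇒≡2⊎odd {p} p-prime with even⊎odd p
  ... | inj₂ odd = inj₂ odd
  ... | inj₁ (h , p≡h+h) with prime⇒irreducible p-prime (divides h (trans p≡h+h (h+h≡h*2 h)))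
    where
    h+h≡h*2 : ∀ h → h + h ≡ h * 2
    h+h≡h*2 = solve-∀
  ...   | inj₁ ()
  ...   | inj₂ 2≡p = inj₁ (sym 2≡p)

  [1+2m∸1]/2≡m : ∀ m → (suc (m + m) ∸ 1) / 2 ≡ m
  [1+2m∸1]/2≡m m = trans (cong (_/ 2) (trans (cong (m +_) (sym (*-identityˡ m))) (sym (*-comm m 2)))) (m*n/n≡m m 2)

module NegativeBinomial where

  open import Data.Nat.Base as ℕ using (ℕ; zero; suc; _!)
  import Data.Nat.Properties as ℕ
  open import Data.Nat.DivMod using (m*n/n≡m; m*n%n≡0)
  open import Data.Nat.Combinatorics using (_C_)
  open import Data.Integer.Base using (ℤ; +_; -[1+_]; -1ℤ; _+_; _-_; _*_; -_; _^_; _/ℕ_)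
  open import Data.Integer.Properties using (pos-*; pos-+)
  open import Data.Integer.Tactic.RingSolver using (solve-∀)
  open import Relation.Binary.PropositionalEquality
  open Binomial using (rising; rising-k[1+k]≡[1+k]!*2kC[1+k])
  open ≡-Reasoning

  [i*d]/ℕd≡i : ∀ i d .{{_ : ℕ.NonZero d}} → (i * + d) /ℕ d ≡ i
  [i*d]/ℕd≡i (+ n)    d = trans (cong (_/ℕ d) (sym (pos-* n d))) (cong +_ (m*n/n≡m n d))
  -- _/ℕ_ on a negative dividend branches on the remainder, which is 0 here.
  [i*d]/ℕd≡i -[1+ n ] d@(suc _) with suc n ℕ.* d ℕ.% d in rem
  ... | zero  = cong (λ m → - (+ m)) (m*n/n≡m (suc n) d)
  ... | suc _ with () ← trans (sym rem) (m*n%n≡0 (suc n) d)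

  fallingℤ-neg : ∀ k j → fallingℤ (- + k) j ≡ -1ℤ ^ j * + rising k j
  fallingℤ-neg k zero    = refl
  fallingℤ-neg k (suc j) = begin
    fallingℤ (- + k) j * (- + k - + j)                 ≡⟨ cong (_* (- + k - + j)) (fallingℤ-neg k j) ⟩
    -1ℤ ^ j * + rising k j * (- + k - + j)             ≡⟨ rearrange (-1ℤ ^ j) (+ rising k j) (+ k) (+ j) ⟩
    -1ℤ * -1ℤ ^ j * (+ rising k j * (+ k + + j))       ≡⟨ cong (λ x → -1ℤ * -1ℤ ^ j * (+ rising k j * x)) (sym (pos-+ k j)) ⟩
    -1ℤ * -1ℤ ^ j * (+ rising k j * + (k ℕ.+ j))       ≡⟨ cong (-1ℤ * -1ℤ ^ j *_) (sym (pos-* (rising k j) (k ℕ.+ j))) ⟩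
    -1ℤ * -1ℤ ^ j * + (rising k j ℕ.* (k ℕ.+ j))       ∎
    where
    rearrange : ∀ s r k j → s * r * (- k - j) ≡ -1ℤ * s * (r * (k + j))
    rearrange = solve-∀

  binomℤ-neg : ∀ k → binomℤ (- + k) (suc k) ≡ -1ℤ ^ suc k * + ((k ℕ.+ k) C suc k)
  binomℤ-neg k = begin
    fallingℤ (- + k) (suc k) /ℕ d           ≡⟨ cong (_/ℕ d) (fallingℤ-neg k (suc k)) ⟩
    s * + rising k (suc k) /ℕ d             ≡⟨ cong (λ n → s * + n /ℕ d) (rising-k[1+k]≡[1+k]!*2kC[1+k] k) ⟩
    s * + (d ℕ.* c) /ℕ d                    ≡⟨ cong (_/ℕ d) (trans (cong (s *_) (pos-* d c)) (reorder s (+ d) (+ c))) ⟩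
    s * + c * + d /ℕ d                      ≡⟨ [i*d]/ℕd≡i (s * + c) d ⟩
    s * + c                                 ∎
    where
    d c : ℕ
    d = suc k !
    c = (k ℕ.+ k) C suc k
    s : ℤ
    s = -1ℤ ^ suc k
    instance
      d≢0 : ℕ.NonZero d
      d≢0 = ℕ._!≢0 (suc k)
    reorder : ∀ s d c → s * (d * c) ≡ s * c * d
    reorder = solve-∀

open Binomial
open Arithmetic
open NegativeBinomial

module RingLemmas {a ℓ} (F : CommutativeRing a ℓ) where

  open CommutativeRing F
  open import Data.Nat.Base using (zero; _≤_; _<_; z≤n; s≤s)
  import Data.Nat.Properties as ℕ
  open import Data.Nat.Combinatorics using (_C_)
  open import Data.Integer.Base as ℤ using (+_; -[1+_]; _⊖_; _◃_; sign; ∣_∣)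
  import Data.Integer.Properties as ℤ
  import Data.Sign.Base as Sign
  open import Data.Fin.Base using (toℕ)
  open import Data.Maybe.Base using (Maybe; just; nothing)
  open import Data.Empty using (⊥-elim)
  import Algebra.Solver.Ring as Solver
  import Algebra.Solver.Ring.AlmostCommutativeRing as ACR
  open import Algebra.Definitions.RawSemiring (Semiring.rawSemiring semiring) using () renaming (_×_ to _·ₙ_)
  open import Algebra.Properties.Semiring.Exp semiring using (_^_; ^-congˡ)
  open import Algebra.Properties.CommutativeSemiring.Exp commutativeSemiring using (^-distrib-*)
  open import Algebra.Properties.Monoid.Sum +-monoid using (sum; sum-cong-≋)
  import Algebra.Properties.CommutativeSemiring.Binomial commutativeSemiring as BinomialTheorem
  open import Algebra.Properties.Monoid.Mult +-monoid using (×-congʳ; ×-homo-+)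
  open import Algebra.Properties.Semiring.Mult semiring using (×-assoc-*; ×1-homo-*)
  open import Algebra.Properties.Ring ring using (-‿involutive; -0#≈0#; -‿+-comm; -1*x≈-x)
  import Algebra.Properties.CommutativeSemigroup +-commutativeSemigroup as CS+
  import Algebra.Properties.CommutativeSemigroup *-commutativeSemigroup as CS*
  open import Relation.Binary.Reasoning.Setoid setoid

  [_] : ℕ → Carrier
  [ n ] = n ·ₙ 1#

  [m+n]≈[m]+[n] : ∀ m n → [ m ℕ.+ n ] ≈ [ m ] + [ n ]
  [m+n]≈[m]+[n] = ×-homo-+ 1#

  [m*n]≈[m]*[n] : ∀ m n → [ m ℕ.* n ] ≈ [ m ] * [ n ]
  [m*n]≈[m]*[n] = ×1-homo-*

  [1]≈1 : [ 1 ] ≈ 1#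
  [1]≈1 = +-identityʳ 1#

  [m]≈0⇒[k*m]≈0 : ∀ m → [ m ] ≈ 0# → ∀ k → [ k ℕ.* m ] ≈ 0#
  [m]≈0⇒[k*m]≈0 m [m]≈0 k = trans ([m*n]≈[m]*[n] k m) (trans (*-congˡ [m]≈0) (zeroʳ [ k ]))

  [m]≈0⇒[1+k*m]≈1 : ∀ m → [ m ] ≈ 0# → ∀ k → [ suc (k ℕ.* m) ] ≈ 1#
  [m]≈0⇒[1+k*m]≈1 m [m]≈0 k = trans (+-congˡ ([m]≈0⇒[k*m]≈0 m [m]≈0 k)) (+-identityʳ 1#)

  ι-⊖ : ∀ m n → ι F (m ⊖ n) ≈ [ m ] - [ n ]
  ι-⊖ m       zero    = sym (trans (+-congˡ -0#≈0#) (+-identityʳ [ m ]))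
  ι-⊖ zero    (suc n) = sym (+-identityˡ _)
  ι-⊖ (suc m) (suc n) = begin
    ι F (suc m ⊖ suc n)             ≡⟨ ≡.cong (ι F) (ℤ.[1+m]⊖[1+n]≡m⊖n m n) ⟩
    ι F (m ⊖ n)                     ≈⟨ ι-⊖ m n ⟩
    [ m ] - [ n ]                   ≈⟨ +-congʳ (+-identityˡ [ m ]) ⟨
    (0# + [ m ]) - [ n ]            ≈⟨ +-congʳ (+-congʳ (-‿inverseʳ 1#)) ⟨
    (1# - 1#) + [ m ] - [ n ]       ≈⟨ +-congʳ (+-assoc 1# (- 1#) [ m ]) ⟩
    1# + (- 1# + [ m ]) - [ n ]     ≈⟨ +-congʳ (+-congˡ (+-comm (- 1#) [ m ])) ⟩
    1# + ([ m ] - 1#) - [ n ]       ≈⟨ +-congʳ (+-assoc 1# [ m ] (- 1#)) ⟨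
    (1# + [ m ]) - 1# - [ n ]       ≈⟨ +-assoc (1# + [ m ]) (- 1#) (- [ n ]) ⟩
    (1# + [ m ]) + (- 1# - [ n ])   ≈⟨ +-congˡ (-‿+-comm 1# [ n ]) ⟩
    (1# + [ m ]) - (1# + [ n ])     ∎

  ι-neg : ∀ i → ι F (ℤ.- i) ≈ - ι F i
  ι-neg (+ zero)  = sym -0#≈0#
  ι-neg (+ suc n) = refl
  ι-neg -[1+ n ]  = sym (-‿involutive _)

  ι-+ : ∀ i j → ι F (i ℤ.+ j) ≈ ι F i + ι F j
  ι-+ (+ m)    (+ n)    = [m+n]≈[m]+[n] m n
  ι-+ (+ m)    -[1+ n ] = ι-⊖ m (suc n)
  ι-+ -[1+ m ] (+ n)    = trans (ι-⊖ n (suc m)) (+-comm _ _)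
  ι-+ -[1+ m ] -[1+ n ] = begin
    - [ suc (suc (m ℕ.+ n)) ]   ≡⟨ ≡.cong (λ k → - [ suc k ]) (ℕ.+-suc m n) ⟨
    - [ suc m ℕ.+ suc n ]       ≈⟨ -‿cong ([m+n]≈[m]+[n] (suc m) (suc n)) ⟩
    - ([ suc m ] + [ suc n ])   ≈⟨ -‿+-comm _ _ ⟨
    - [ suc m ] + - [ suc n ]   ∎

  sg : Sign.Sign → Carrier
  sg Sign.+ = 1#
  sg Sign.- = - 1#

  sg-* : ∀ s t → sg (s Sign.* t) ≈ sg s * sg t
  sg-* Sign.+ t      = sym (*-identityˡ _)
  sg-* Sign.- Sign.+ = sym (*-identityʳ _)
  sg-* Sign.- Sign.- = sym (trans (-1*x≈-x (- 1#)) (-‿involutive 1#))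

  ι-◃ : ∀ s n → ι F (s ◃ n) ≈ sg s * [ n ]
  ι-◃ s      zero    = sym (zeroʳ _)
  ι-◃ Sign.+ (suc n) = sym (*-identityˡ _)
  ι-◃ Sign.- (suc n) = sym (-1*x≈-x _)

  ι-* : ∀ i j → ι F (i ℤ.* j) ≈ ι F i * ι F j
  ι-* i j = begin
    ι F (i ℤ.* j)                                    ≈⟨ ι-◃ (sign i Sign.* sign j) (∣ i ∣ ℕ.* ∣ j ∣) ⟩
    sg (sign i Sign.* sign j) * [ ∣ i ∣ ℕ.* ∣ j ∣ ]  ≈⟨ *-cong (sg-* (sign i) (sign j)) ([m*n]≈[m]*[n] ∣ i ∣ ∣ j ∣) ⟩
    (sg (sign i) * sg (sign j)) * ([ ∣ i ∣ ] * [ ∣ j ∣ ]) ≈⟨ CS*.interchange _ _ _ _ ⟩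
    (sg (sign i) * [ ∣ i ∣ ]) * (sg (sign j) * [ ∣ j ∣ ]) ≈⟨ *-cong (ι-sign-abs i) (ι-sign-abs j) ⟩
    ι F i * ι F j                                    ∎
    where
    ι-sign-abs : ∀ i → sg (sign i) * [ ∣ i ∣ ] ≈ ι F i
    ι-sign-abs i = trans (sym (ι-◃ (sign i) ∣ i ∣)) (reflexive (≡.cong (ι F) (ℤ.◃-inverse i)))

  ι-morphism : ℤ.+-*-rawRing ACR.-Raw-AlmostCommutative⟶ ACR.fromCommutativeRing F
  ι-morphism = record
    { ⟦_⟧ = ι F ; +-homo = ι-+ ; *-homo = ι-* ; -‿homo = ι-neg ; 0-homo = refl ; 1-homo = [1]≈1 }

  ι-≟ : ∀ i j → Maybe (ι F i ≈ ι F j)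
  ι-≟ i j with i ℤ.≟ j
  ... | yes ≡.refl = just refl
  ... | no _       = nothing

  open Solver ℤ.+-*-rawRing (ACR.fromCommutativeRing F) ι-morphism ι-≟ public
    using (solve; _:=_; _:+_; _:*_; :-_; _:-_; con)

  Σ≤ : ℕ → (ℕ → Carrier) → Carrier
  Σ≤ = sumTo F

  Σ≤-cong : ∀ n {f g : ℕ → Carrier} → (∀ k → k ≤ n → f k ≈ g k) → Σ≤ n f ≈ Σ≤ n g
  Σ≤-cong zero    f≈g = f≈g 0 z≤n
  Σ≤-cong (suc n) f≈g = +-cong (Σ≤-cong n (λ k k≤n → f≈g k (ℕ.m≤n⇒m≤1+n k≤n))) (f≈g (suc n) ℕ.≤-refl)

  Σ≤-suc : ∀ n f → Σ≤ (suc n) f ≈ f 0 + Σ≤ n (f ∘ suc)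
  Σ≤-suc zero    f = refl
  Σ≤-suc (suc n) f = trans (+-congʳ (Σ≤-suc n f)) (+-assoc _ _ _)

  Σ≤-+ : ∀ n f g → Σ≤ n (λ k → f k + g k) ≈ Σ≤ n f + Σ≤ n g
  Σ≤-+ zero    f g = refl
  Σ≤-+ (suc n) f g = trans (+-congʳ (Σ≤-+ n f g)) (CS+.interchange _ _ _ _)

  *-distribˡ-Σ≤ : ∀ n a f → a * Σ≤ n f ≈ Σ≤ n (λ k → a * f k)
  *-distribˡ-Σ≤ zero    a f = refl
  *-distribˡ-Σ≤ (suc n) a f = trans (distribˡ _ _ _) (+-congʳ (*-distribˡ-Σ≤ n a f))

  -‿Σ≤ : ∀ n f → Σ≤ n (λ k → - f k) ≈ - Σ≤ n f
  -‿Σ≤ zero    f = refl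
  -‿Σ≤ (suc n) f = trans (+-congʳ (-‿Σ≤ n f)) (-‿+-comm _ _)

  Σ≤-zero : ∀ n {f} → (∀ k → k ≤ n → f k ≈ 0#) → Σ≤ n f ≈ 0#
  Σ≤-zero zero    f≈0 = f≈0 0 z≤n
  Σ≤-zero (suc n) f≈0 =
    trans (+-cong (Σ≤-zero n (λ k k≤n → f≈0 k (ℕ.m≤n⇒m≤1+n k≤n))) (f≈0 (suc n) ℕ.≤-refl)) (+-identityʳ 0#)

  Σ≤-single : ∀ n c f → c ≤ n → (∀ k → k ≤ n → k ≢ c → f k ≈ 0#) → Σ≤ n f ≈ f c
  Σ≤-single zero    zero f _ _ = refl
  Σ≤-single (suc n) c f c≤n f≈0 with c ℕ.≟ suc n
  ... | yes ≡.refl =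
    trans (+-congʳ (Σ≤-zero n (λ k k≤n → f≈0 k (ℕ.m≤n⇒m≤1+n k≤n) (ℕ.<⇒≢ (s≤s k≤n))))) (+-identityˡ _)
  ... | no c≢1+n   =
    trans (+-cong (Σ≤-single n c f (ℕ.m<1+n⇒m≤n (ℕ.≤∧≢⇒< c≤n c≢1+n)) (λ k k≤n → f≈0 k (ℕ.m≤n⇒m≤1+n k≤n)))
                  (f≈0 (suc n) ℕ.≤-refl (c≢1+n ∘ ≡.sym)))
          (+-identityʳ _)

  Σ≤-pair : ∀ n c f → 0 < c → c ≤ n → (∀ k → 0 < k → k ≤ n → k ≢ c → f k ≈ 0#) → Σ≤ n f ≈ f 0 + f c
  Σ≤-pair (suc n) (suc c) f _ (s≤s c≤n) f≈0 = trans (Σ≤-suc n f)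
    (+-congˡ (Σ≤-single n c (f ∘ suc) c≤n (λ k k≤n k≢c → f≈0 (suc k) (s≤s z≤n) (s≤s k≤n) (k≢c ∘ ℕ.suc-injective))))

  Σ≤≈∑ : ∀ n f → Σ≤ n f ≈ sum {suc n} (f ∘ toℕ)
  Σ≤≈∑ zero    f = sym (+-identityʳ (f 0))
  Σ≤≈∑ (suc n) f = trans (Σ≤-suc n f) (+-congˡ (Σ≤≈∑ n (f ∘ suc)))

  ·ₙ≈[]* : ∀ m x → m ·ₙ x ≈ [ m ] * x
  ·ₙ≈[]* m x = sym (trans (×-assoc-* m 1# x) (×-congʳ m (*-identityˡ x)))

  1^n≈1 : ∀ n → 1# ^ n ≈ 1#
  1^n≈1 zero    = refl
  1^n≈1 (suc n) = trans (*-identityˡ _) (1^n≈1 n)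

  binomial : ∀ n y → (1# + y) ^ n ≈ Σ≤ n (λ k → [ n C k ] * y ^ k)
  binomial n y = begin
    (1# + y) ^ n                                            ≈⟨ ^-congˡ n (+-comm 1# y) ⟩
    (y + 1#) ^ n                                            ≈⟨ BinomialTheorem.theorem n y 1# ⟩
    sum {suc n} (λ k → (n C toℕ k) ·ₙ (y ^ toℕ k * 1# ^ (n ℕ.∸ toℕ k))) ≈⟨ sum-cong-≋ {suc n} (λ k → term (toℕ k)) ⟩
    sum {suc n} (λ k → [ n C toℕ k ] * y ^ toℕ k)                   ≈⟨ Σ≤≈∑ n (λ k → [ n C k ] * y ^ k) ⟨
    Σ≤ n (λ k → [ n C k ] * y ^ k)                          ∎
    where
    term : ∀ k → (n C k) ·ₙ (y ^ k * 1# ^ (n ℕ.∸ k)) ≈ [ n C k ] * y ^ k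
    term k = trans (·ₙ≈[]* (n C k) _) (*-congˡ (trans (*-congˡ (1^n≈1 (n ℕ.∸ k))) (*-identityʳ _)))

  -- Multiplied by 1 + y so that m = 0 needs no exception.
  Σ≤-k*mCk*[1+y] : ∀ m y → Σ≤ m (λ k → [ k ℕ.* (m C k) ] * y ^ k) * (1# + y) ≈ [ m ] * y * (1# + y) ^ m
  Σ≤-k*mCk*[1+y] zero    y = trans (trans (*-congʳ (zeroˡ 1#)) (zeroˡ _)) (sym (trans (*-congʳ (zeroˡ y)) (zeroˡ 1#)))
  Σ≤-k*mCk*[1+y] (suc m) y = begin
    Σ≤ (suc m) f * (1# + y)
      ≈⟨ *-congʳ (Σ≤-suc m f) ⟩
    (f 0 + Σ≤ m (f ∘ suc)) * (1# + y)
      ≈⟨ *-congʳ (+-cong (zeroˡ _) (Σ≤-cong m (λ j _ → term j))) ⟩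
    (0# + Σ≤ m (λ j → [ suc m ] * (y * g j))) * (1# + y)
      ≈⟨ *-congʳ (+-identityˡ _) ⟩
    Σ≤ m (λ j → [ suc m ] * (y * g j)) * (1# + y)
      ≈⟨ *-congʳ (*-distribˡ-Σ≤ m [ suc m ] _) ⟨
    [ suc m ] * Σ≤ m (λ j → y * g j) * (1# + y)
      ≈⟨ *-congʳ (*-congˡ (*-distribˡ-Σ≤ m y g)) ⟨
    [ suc m ] * (y * Σ≤ m g) * (1# + y)
      ≈⟨ *-congʳ (*-congˡ (*-congˡ (binomial m y))) ⟨
    [ suc m ] * (y * (1# + y) ^ m) * (1# + y)
      ≈⟨ solve 4 (λ a y u v → a :* (y :* u) :* v := a :* y :* (v :* u)) refl [ suc m ] y ((1# + y) ^ m) (1# + y) ⟩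
    [ suc m ] * y * (1# + y) ^ suc m ∎
    where
    f g : ℕ → Carrier
    f k = [ k ℕ.* (suc m C k) ] * y ^ k
    g j = [ m C j ] * y ^ j
    term : ∀ j → f (suc j) ≈ [ suc m ] * (y * g j)
    term j = begin
      [ suc j ℕ.* (suc m C suc j) ] * (y * y ^ j)
        ≡⟨ ≡.cong (λ n → [ n ] * (y * y ^ j)) ([1+k]*[1+n]C[1+k]≡[1+n]*nCk m j) ⟩
      [ suc m ℕ.* (m C j) ] * (y * y ^ j)
        ≈⟨ *-congʳ ([m*n]≈[m]*[n] (suc m) (m C j)) ⟩
      [ suc m ] * [ m C j ] * (y * y ^ j)
        ≈⟨ solve 4 (λ a b y Y → a :* b :* (y :* Y) := a :* (y :* (b :* Y))) refl [ suc m ] [ m C j ] y (y ^ j) ⟩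
      [ suc m ] * (y * ([ m C j ] * y ^ j)) ∎

  vandermonde : ∀ b m J → [ (b ℕ.+ m) C J ] ≈ Σ≤ J (λ i → [ b C i ] * [ m C (J ℕ.∸ i) ])
  vandermonde zero m J = sym (trans
    (Σ≤-single J 0 _ z≤n (λ { zero _ 0≢0 → ⊥-elim (0≢0 ≡.refl) ; (suc k) _ _ → zeroˡ _ }))
    (trans (*-congʳ [1]≈1) (*-identityˡ _)))
  vandermonde (suc b) m zero = sym (trans (*-congʳ [1]≈1) (*-identityˡ _))
  vandermonde (suc b) m (suc J) = begin
    [ suc (b ℕ.+ m) C suc J ]
      ≡⟨ ≡.cong [_] (pascal (b ℕ.+ m) J) ⟩
    [ (b ℕ.+ m) C J ℕ.+ (b ℕ.+ m) C suc J ]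
      ≈⟨ [m+n]≈[m]+[n] ((b ℕ.+ m) C J) ((b ℕ.+ m) C suc J) ⟩
    [ (b ℕ.+ m) C J ] + [ (b ℕ.+ m) C suc J ]
      ≈⟨ +-cong (vandermonde b m J) (trans (vandermonde b m (suc J)) (Σ≤-suc J _)) ⟩
    Σ≤ J A + ([ b C 0 ] * [ m C suc J ] + Σ≤ J B)
      ≈⟨ CS+.x∙yz≈y∙xz _ _ _ ⟩
    [ b C 0 ] * [ m C suc J ] + (Σ≤ J A + Σ≤ J B)
      ≈⟨ +-congˡ (Σ≤-+ J A B) ⟨
    [ b C 0 ] * [ m C suc J ] + Σ≤ J (λ i → A i + B i)
      ≈⟨ +-congˡ (Σ≤-cong J (λ i _ → pascal-term i)) ⟩
    [ b C 0 ] * [ m C suc J ] + Σ≤ J (λ i → [ suc b C suc i ] * [ m C (J ℕ.∸ i) ])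
      ≈⟨ Σ≤-suc J _ ⟨
    Σ≤ (suc J) (λ i → [ suc b C i ] * [ m C (suc J ℕ.∸ i) ]) ∎
    where
    A B : ℕ → Carrier
    A i = [ b C i ] * [ m C (J ℕ.∸ i) ]
    B i = [ b C suc i ] * [ m C (J ℕ.∸ i) ]
    pascal-term : ∀ i → A i + B i ≈ [ suc b C suc i ] * [ m C (J ℕ.∸ i) ]
    pascal-term i = trans (sym (distribʳ _ _ _))
      (*-congʳ (trans (sym ([m+n]≈[m]+[n] (b C i) (b C suc i))) (reflexive (≡.cong [_] (≡.sym (pascal b i))))))

  ι-^ : ∀ i n → ι F (i ℤ.^ n) ≈ ι F i ^ n
  ι-^ i zero    = [1]≈1
  ι-^ i (suc n) = trans (ι-* i (i ℤ.^ n)) (*-congˡ (ι-^ i n))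

  [1+k]*[mC[1+k]]≈[[m]-[k]]*[mCk] : ∀ m k → [ suc k ] * [ m C suc k ] ≈ ([ m ] - [ k ]) * [ m C k ]
  [1+k]*[mC[1+k]]≈[[m]-[k]]*[mCk] m k = begin
    [ suc k ] * [ m C suc k ]
      ≈⟨ solve 2 (λ x y → x := x :+ y :- y) refl ([ suc k ] * [ m C suc k ]) ([ k ] * [ m C k ]) ⟩
    [ suc k ] * [ m C suc k ] + [ k ] * [ m C k ] - [ k ] * [ m C k ]
      ≈⟨ +-congʳ sum≈ ⟩
    [ m ] * [ m C k ] - [ k ] * [ m C k ]
      ≈⟨ solve 3 (λ x y z → x :* z :- y :* z := (x :- y) :* z) refl [ m ] [ k ] [ m C k ] ⟩
    ([ m ] - [ k ]) * [ m C k ] ∎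
    where
    sum≈ : [ suc k ] * [ m C suc k ] + [ k ] * [ m C k ] ≈ [ m ] * [ m C k ]
    sum≈ = begin
      [ suc k ] * [ m C suc k ] + [ k ] * [ m C k ]
        ≈⟨ +-cong ([m*n]≈[m]*[n] (suc k) (m C suc k)) ([m*n]≈[m]*[n] k (m C k)) ⟨
      [ suc k ℕ.* (m C suc k) ] + [ k ℕ.* (m C k) ]
        ≈⟨ [m+n]≈[m]+[n] (suc k ℕ.* (m C suc k)) (k ℕ.* (m C k)) ⟨
      [ suc k ℕ.* (m C suc k) ℕ.+ k ℕ.* (m C k) ]
        ≡⟨ ≡.cong [_] ([1+k]*nC[1+k]+k*nCk≡n*nCk m k) ⟩
      [ m ℕ.* (m C k) ]
        ≈⟨ [m*n]≈[m]*[n] m (m C k) ⟩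
      [ m ] * [ m C k ] ∎

  central-recurrence : ∀ k → [ suc k ] * [ (suc k ℕ.+ suc k) C suc k ] ≈ [ 2 ℕ.* suc (k ℕ.+ k) ] * [ (k ℕ.+ k) C k ]
  central-recurrence k = begin
    [ suc k ] * [ (suc k ℕ.+ suc k) C suc k ]        ≈⟨ [m*n]≈[m]*[n] (suc k) ((suc k ℕ.+ suc k) C suc k) ⟨
    [ suc k ℕ.* ((suc k ℕ.+ suc k) C suc k) ]        ≡⟨ ≡.cong [_] ([1+k]*[2+2k]C[1+k]≡2*[1+2k]*2kCk k) ⟩
    [ 2 ℕ.* suc (k ℕ.+ k) ℕ.* ((k ℕ.+ k) C k) ]      ≈⟨ [m*n]≈[m]*[n] (2 ℕ.* suc (k ℕ.+ k)) ((k ℕ.+ k) C k) ⟩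
    [ 2 ℕ.* suc (k ℕ.+ k) ] * [ (k ℕ.+ k) C k ]      ∎

  summand : Carrier → ℕ → Carrier
  summand z k = ι F (+ suc k) * ι F (binomℤ (ℤ.- (+ k)) (suc k)) * z ^ k

  summand≈ : ∀ z k → summand z k ≈ - ([ k ℕ.* ((k ℕ.+ k) C k) ] * (- z) ^ k)
  summand≈ z k = begin
    [ suc k ] * ι F (binomℤ (ℤ.- (+ k)) (suc k)) * z ^ k
      ≡⟨ ≡.cong (λ i → [ suc k ] * ι F i * z ^ k) (binomℤ-neg k) ⟩
    [ suc k ] * ι F (ℤ.-1ℤ ℤ.^ suc k ℤ.* + c) * z ^ k
      ≈⟨ *-congʳ (*-congˡ (trans (ι-* (ℤ.-1ℤ ℤ.^ suc k) (+ c)) (*-congʳ ι[-1^n]))) ⟩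
    [ suc k ] * (- 1# * u * [ c ]) * z ^ k
      ≈⟨ *-congʳ (*-congˡ (*-congʳ (-1*x≈-x u))) ⟩
    [ suc k ] * (- u * [ c ]) * z ^ k
      ≈⟨ solve 4 (λ a u c Z → a :* (:- u :* c) :* Z := :- (a :* c :* (u :* Z))) refl [ suc k ] u [ c ] (z ^ k) ⟩
    - ([ suc k ] * [ c ] * (u * z ^ k))
      ≈⟨ -‿cong (*-cong (sym ([m*n]≈[m]*[n] (suc k) c)) (sym (^-distrib-* (- 1#) z k))) ⟩
    - ([ suc k ℕ.* c ] * (- 1# * z) ^ k)
      ≈⟨ -‿cong (*-cong (reflexive (≡.cong [_] ([1+k]*2kC[1+k]≡k*2kCk k))) (^-congˡ k (-1*x≈-x z))) ⟩
    - ([ k ℕ.* ((k ℕ.+ k) C k) ] * (- z) ^ k) ∎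
    where
    c : ℕ
    c = (k ℕ.+ k) C suc k
    u : Carrier
    u = (- 1#) ^ k
    ι[-1^n] : ι F (ℤ.-1ℤ ℤ.^ suc k) ≈ (- 1#) ^ suc k
    ι[-1^n] = trans (ι-^ ℤ.-1ℤ (suc k)) (^-congˡ (suc k) (-‿cong [1]≈1))

  Σ≤-summand : ∀ M z → Σ≤ M (summand z) ≈ - Σ≤ M (λ k → [ k ℕ.* ((k ℕ.+ k) C k) ] * (- z) ^ k)
  Σ≤-summand M z = trans (Σ≤-cong M (λ k _ → summand≈ z k)) (-‿Σ≤ M _)

  [2]≈0⇒Σ≤-summand≈2zw : [ 2 ] ≈ 0# → ∀ M z w → Σ≤ M (summand z) ≈ 2 ·ₙ z * w
  [2]≈0⇒Σ≤-summand≈2zw [2]≈0 M z w = begin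
    Σ≤ M (summand z)
      ≈⟨ Σ≤-summand M z ⟩
    - Σ≤ M (λ k → [ k ℕ.* ((k ℕ.+ k) C k) ] * (- z) ^ k)
      ≈⟨ -‿cong (Σ≤-zero M (λ k _ → trans (*-congʳ (even k)) (zeroˡ _))) ⟩
    - 0#
      ≈⟨ -0#≈0# ⟩
    0#
      ≈⟨ trans (*-congʳ (trans (*-congʳ [2]≈0) (zeroˡ z))) (zeroˡ w) ⟨
    [ 2 ] * z * w
      ≈⟨ *-congʳ (·ₙ≈[]* 2 z) ⟨
    2 ·ₙ z * w ∎
    where
    even : ∀ k → [ k ℕ.* ((k ℕ.+ k) C k) ] ≈ 0#
    even zero    = refl
    even (suc k) = begin
      [ suc k ℕ.* ((suc k ℕ.+ suc k) C suc k) ]       ≈⟨ [m*n]≈[m]*[n] (suc k) ((suc k ℕ.+ suc k) C suc k) ⟩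
      [ suc k ] * [ (suc k ℕ.+ suc k) C suc k ]       ≈⟨ central-recurrence k ⟩
      [ 2 ℕ.* suc (k ℕ.+ k) ] * [ (k ℕ.+ k) C k ]     ≈⟨ *-congʳ ([m*n]≈[m]*[n] 2 (suc (k ℕ.+ k))) ⟩
      [ 2 ] * [ suc (k ℕ.+ k) ] * [ (k ℕ.+ k) C k ]   ≈⟨ trans (*-congʳ (trans (*-congʳ [2]≈0) (zeroˡ _))) (zeroˡ _) ⟩
      0#                                              ∎

module FieldLemmas {a ℓ} (F : CommutativeRing a ℓ) where

  open CommutativeRing F
  open RingLemmas F
  open import Data.Nat.Base using (zero)
  open import Data.Fin.Base as Fin using (Fin; punchIn)
  import Data.Fin.Properties as Fin
  open import Data.Fin.Permutation using (Permutation; permutation; _⟨$⟩ʳ_)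
  open import Data.Vec.Functional using (removeAt)
  open import Data.Empty using (⊥-elim)
  open import Relation.Binary.Definitions using (Decidable)
  import Algebra.Properties.CommutativeMonoid.Sum *-commutativeMonoid as Π
  open import Algebra.Definitions.RawSemiring (Semiring.rawSemiring semiring) using () renaming (_×_ to _·ₙ_)
  open import Algebra.Properties.Semiring.Exp semiring using (_^_; ^-homo-*)
  open import Algebra.Properties.CommutativeSemiring.Exp commutativeSemiring using (^-distrib-*)
  open import Algebra.Properties.Group +-group using (x∙y⁻¹≈ε⇒x≈y)
  open import Algebra.Properties.Ring ring using (-0#≈0#)
  open import Data.Integer.Base using (+_)
  open import Relation.Binary.Reasoning.Setoid setoid

  module _ (isField : IsField F) where

    *-cancelˡ : ∀ {x y z} → ¬ x ≈ 0# → x * y ≈ x * z → y ≈ z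
    *-cancelˡ {x} {y} {z} x≉0 xy≈xz with proj₂ isField x x≉0
    ... | x⁻¹ , xx⁻¹≈1 = begin
      y                ≈⟨ *-identityˡ y ⟨
      1# * y           ≈⟨ *-congʳ x⁻¹x≈1 ⟨
      x⁻¹ * x * y      ≈⟨ *-assoc x⁻¹ x y ⟩
      x⁻¹ * (x * y)    ≈⟨ *-congˡ xy≈xz ⟩
      x⁻¹ * (x * z)    ≈⟨ *-assoc x⁻¹ x z ⟨
      x⁻¹ * x * z      ≈⟨ *-congʳ x⁻¹x≈1 ⟩
      1# * z           ≈⟨ *-identityˡ z ⟩
      z                ∎
      where
      x⁻¹x≈1 : x⁻¹ * x ≈ 1#
      x⁻¹x≈1 = trans (*-comm x⁻¹ x) xx⁻¹≈1

    *-≉0 : ∀ {x y} → ¬ x ≈ 0# → ¬ y ≈ 0# → ¬ x * y ≈ 0#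
    *-≉0 {x} x≉0 y≉0 xy≈0 = y≉0 (*-cancelˡ x≉0 (trans xy≈0 (sym (zeroʳ x))))

    discriminant : ∀ {α β z} → ¬ α ≈ β → α * α + α - z ≈ 0# → β * β + β - z ≈ 0# →
                   (α - β) * (α - β) ≈ 1# + 4 ·ₙ z
    discriminant {α} {β} {z} α≉β α-root β-root = begin
      (α - β) * (α - β)
        ≈⟨ expand α β z ⟩
      [ 1 ] + [ 4 ] * z + [ 2 ] * (α * α + α - z) + [ 2 ] * (β * β + β - z) - s * s
        ≈⟨ +-cong (+-cong (+-congˡ (2*-vanish α-root)) (2*-vanish β-root)) (-‿cong (trans (*-congˡ s≈0) (zeroʳ s))) ⟩
      [ 1 ] + [ 4 ] * z + 0# + 0# - 0#
        ≈⟨ trans (+-congˡ -0#≈0#) (trans (+-identityʳ _) (trans (+-identityʳ _) (+-identityʳ _))) ⟩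
      [ 1 ] + [ 4 ] * z
        ≈⟨ +-cong [1]≈1 (sym (·ₙ≈[]* 4 z)) ⟩
      1# + 4 ·ₙ z ∎
      where
      s : Carrier
      s = α + β + [ 1 ]
      2*-vanish : ∀ {x} → x ≈ 0# → [ 2 ] * x ≈ 0#
      2*-vanish x≈0 = trans (*-congˡ x≈0) (zeroʳ [ 2 ])
      expand : ∀ α β z → (α - β) * (α - β) ≈
        [ 1 ] + [ 4 ] * z + [ 2 ] * (α * α + α - z) + [ 2 ] * (β * β + β - z) - (α + β + [ 1 ]) * (α + β + [ 1 ])
      expand = solve 3 (λ α β z → (α :- β) :* (α :- β) :=
        con (+ 1) :+ con (+ 4) :* z :+ con (+ 2) :* ((α :* α :+ α) :- z) :+ con (+ 2) :* ((β :* β :+ β) :- z)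
          :- (α :+ β :+ con (+ 1)) :* (α :+ β :+ con (+ 1))) refl
      factor : ∀ α β z → (α - β) * (α + β + [ 1 ]) ≈ (α * α + α - z) - (β * β + β - z)
      factor = solve 3 (λ α β z → (α :- β) :* (α :+ β :+ con (+ 1)) := ((α :* α :+ α) :- z) :- ((β :* β :+ β) :- z)) refl
      s≈0 : s ≈ 0#
      s≈0 = *-cancelˡ (α≉β ∘ x∙y⁻¹≈ε⇒x≈y α β) (begin
        (α - β) * s                          ≈⟨ factor α β z ⟩
        (α * α + α - z) - (β * β + β - z)    ≈⟨ +-cong α-root (-‿cong β-root) ⟩
        0# - 0#                              ≈⟨ -‿inverseʳ 0# ⟩
        0#                                   ≈⟨ zeroʳ (α - β) ⟨
        (α - β) * 0#                         ∎)

    module _ {n} (card : HasCardinality F (suc n)) where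

      private
        enum : Fin (suc n) → Carrier
        enum = proj₁ card
        index : Carrier → Fin (suc n)
        index x = proj₁ (proj₁ (proj₂ card) x)
        enum-index : ∀ x → enum (index x) ≈ x
        enum-index x = proj₂ (proj₁ (proj₂ card) x)
        enum-injective : ∀ i j → enum i ≈ enum j → i ≡ j
        enum-injective = proj₂ (proj₂ card)

      _≟_ : Decidable _≈_
      x ≟ y with index x Fin.≟ index y
      ... | yes ix≡iy = yes (trans (sym (enum-index x)) (trans (reflexive (≡.cong enum ix≡iy)) (enum-index y)))
      ... | no  ix≢iy = no λ x≈y → ix≢iy (enum-injective _ _ (trans (enum-index x) (trans x≈y (sym (enum-index y)))))

      private
        unit : Carrier → Carrier
        unit x with x ≟ 0#
        ... | yes _ = 1#
        ... | no  _ = x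

        unit≉0 : ∀ x → ¬ unit x ≈ 0#
        unit≉0 x with x ≟ 0#
        ... | yes _ = proj₁ isField ∘ sym
        ... | no x≉0 = x≉0

        Π≉0 : ∀ {m} (f : Fin m → Carrier) → (∀ i → ¬ f i ≈ 0#) → ¬ Π.sum f ≈ 0#
        Π≉0 {zero}  f f≉0 = proj₁ isField ∘ sym
        Π≉0 {suc m} f f≉0 = *-≉0 (f≉0 Fin.zero) (Π≉0 (f ∘ Fin.suc) (f≉0 ∘ Fin.suc))

        scaling-inverse : ∀ {d d′} → d * d′ ≈ 1# → ∀ i → index (d * enum (index (d′ * enum i))) ≡ i
        scaling-inverse {d} {d′} dd′≈1 i = enum-injective _ _ (begin
          enum (index (d * enum (index (d′ * enum i))))  ≈⟨ enum-index _ ⟩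
          d * enum (index (d′ * enum i))                 ≈⟨ *-congˡ (enum-index _) ⟩
          d * (d′ * enum i)                              ≈⟨ *-assoc d d′ (enum i) ⟨
          d * d′ * enum i                                ≈⟨ *-congʳ dd′≈1 ⟩
          1# * enum i                                    ≈⟨ *-identityˡ (enum i) ⟩
          enum i                                         ∎)

      -- Multiplication by d permutes the elements; unit (which sends 0 to 1) makes the product
      -- of all of them invertible, so it can be cancelled.
      fermat : ∀ {d} → ¬ d ≈ 0# → d ^ n ≈ 1#
      fermat {d} d≉0 = *-cancelˡ (Π≉0 (unit ∘ enum) (unit≉0 ∘ enum)) (begin
        P * d ^ n                                   ≈⟨ *-comm P (d ^ n) ⟩
        d ^ n * P                                   ≈⟨ *-congʳ Πscale≈d^n ⟨
        Π.sum scale * P                             ≈⟨ Π.∑-distrib-+ scale (unit ∘ enum) ⟨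
        Π.sum (λ i → scale i * unit (enum i))       ≈⟨ Π.sum-cong-≋ unit-scale ⟨
        Π.sum (unit ∘ enum ∘ (π ⟨$⟩ʳ_))             ≈⟨ Π.sum-permute (unit ∘ enum) π ⟨
        P                                           ≈⟨ *-identityʳ P ⟨
        P * 1#                                      ∎)
        where
        P d⁻¹ : Carrier
        P = Π.sum (unit ∘ enum)
        d⁻¹ = proj₁ (proj₂ isField d d≉0)
        dd⁻¹≈1 : d * d⁻¹ ≈ 1#
        dd⁻¹≈1 = proj₂ (proj₂ isField d d≉0)
        π : Permutation (suc n) (suc n)
        π = permutation (λ i → index (d * enum i)) (λ i → index (d⁻¹ * enum i))
              (scaling-inverse dd⁻¹≈1) (scaling-inverse (trans (*-comm d⁻¹ d) dd⁻¹≈1))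
        scale : Fin (suc n) → Carrier
        scale i with enum i ≟ 0#
        ... | yes _ = 1#
        ... | no  _ = d
        unit-scale : ∀ i → unit (enum (π ⟨$⟩ʳ i)) ≈ scale i * unit (enum i)
        unit-scale i with enum (π ⟨$⟩ʳ i) ≟ 0# | enum i ≟ 0#
        ... | yes _   | yes _   = sym (*-identityˡ 1#)
        ... | yes dx≈0 | no x≉0 = ⊥-elim (*-≉0 d≉0 x≉0 (trans (sym (enum-index _)) dx≈0))
        ... | no dx≉0 | yes x≈0 = ⊥-elim (dx≉0 (trans (enum-index _) (trans (*-congˡ x≈0) (zeroʳ d))))
        ... | no _    | no _    = enum-index _
        Πscale≈d^n : Π.sum scale ≈ d ^ n
        Πscale≈d^n = begin
          Π.sum scale                                ≈⟨ Π.sum-remove {i = i₀} scale ⟩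
          scale i₀ * Π.sum (removeAt scale i₀)        ≈⟨ *-cong scale-i₀ (Π.sum-cong-≋ scale-punchIn) ⟩
          1# * Π.sum {n} (λ _ → d)                    ≈⟨ *-identityˡ _ ⟩
          Π.sum {n} (λ _ → d)                         ≈⟨ Π.sum-replicate n ⟩
          d ^ n                                       ∎
          where
          i₀ : Fin (suc n)
          i₀ = index 0#
          scale-i₀ : scale i₀ ≈ 1#
          scale-i₀ with enum i₀ ≟ 0#
          ... | yes _ = refl
          ... | no e≉0 = ⊥-elim (e≉0 (enum-index 0#))
          scale-punchIn : ∀ j → scale (punchIn i₀ j) ≈ d
          scale-punchIn j with enum (punchIn i₀ j) ≟ 0#
          ... | yes e≈0 = ⊥-elim (Fin.punchInᵢ≢i i₀ j (enum-injective _ _ (trans e≈0 (sym (enum-index 0#)))))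
          ... | no _ = refl

    square^half≈1 : ∀ {m} → HasCardinality F (suc (m ℕ.+ m)) → ∀ {x} → ¬ x ≈ 0# → (x * x) ^ m ≈ 1#
    square^half≈1 {m} card {x} x≉0 = trans (^-distrib-* x x m) (trans (sym (^-homo-* x m m)) (fermat card x≉0))

module CharacteristicLemmas {a ℓ} (F : CommutativeRing a ℓ) {p} (p-prime : Prime p) where

  open CommutativeRing F
  open RingLemmas F
  open import Data.Nat.Base using (zero; _≤_; _<_; s≤s)
  import Data.Nat.Properties as ℕ
  open import Data.Nat.Combinatorics using (_C_; k>n⇒nCk≡0; nCn≡1)
  open import Data.Nat.Divisibility using (_∣_; divides)
  open import Data.Nat.Primality using (prime⇒irreducible; prime⇒nonZero)
  open import Data.Nat.Coprimality using (Coprime; coprime-Bézout)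
  import Data.Nat.GCD as GCD
  open import Data.Empty using (⊥-elim)
  open import Relation.Binary.Definitions using (tri<; tri≈; tri>)
  open import Algebra.Properties.Semiring.Exp semiring using (_^_)
  open import Relation.Binary.Reasoning.Setoid setoid

  0<p : 0 < p
  0<p = ℕ.>-nonZero⁻¹ p {{prime⇒nonZero p-prime}}

  module _ ([p]≈0 : [ p ] ≈ 0#) where

    [pCi]≈0 : ∀ {i} → 0 < i → i ≢ p → [ p C i ] ≈ 0#
    [pCi]≈0 {i} 0<i i≢p with ℕ.<-cmp i p
    ... | tri< i<p _ _ with divides c pCi≡c*p ← p∣pCi p-prime 0<i i<p =
      trans (reflexive (≡.cong [_] pCi≡c*p)) ([m]≈0⇒[k*m]≈0 p [p]≈0 c)
    ... | tri≈ _ i≡p _ = ⊥-elim (i≢p i≡p)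
    ... | tri> _ _ i>p = reflexive (≡.cong [_] (k>n⇒nCk≡0 i>p))

    Σ≤-[pCi] : ∀ J (f : ℕ → Carrier) → p ≤ J → Σ≤ J (λ i → [ p C i ] * f i) ≈ f 0 + f p
    Σ≤-[pCi] J f p≤J = trans
      (Σ≤-pair J p _ 0<p p≤J (λ i 0<i _ i≢p → trans (*-congʳ ([pCi]≈0 0<i i≢p)) (zeroˡ (f i))))
      (+-cong (trans (*-congʳ [1]≈1) (*-identityˡ (f 0)))
              (trans (*-congʳ (trans (reflexive (≡.cong [_] (nCn≡1 p))) [1]≈1)) (*-identityˡ (f p))))

    freshman : ∀ y → (1# + y) ^ p ≈ 1# + y ^ p
    freshman y = trans (binomial p y) (Σ≤-[pCi] p (y ^_) ℕ.≤-refl)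

    frobenius : ∀ n → [ n ] ^ p ≈ [ n ]
    frobenius zero    = 0^p≈0 0<p
      where
      0^p≈0 : ∀ {n} → 0 < n → 0# ^ n ≈ 0#
      0^p≈0 (s≤s _) = zeroˡ _
    frobenius (suc n) = trans (freshman [ n ]) (+-congˡ (frobenius n))

    [p+m]CJ≈[mCJ]+[mC[J∸p]] : ∀ m J → p ≤ J → [ (p ℕ.+ m) C J ] ≈ [ m C J ] + [ m C (J ℕ.∸ p) ]
    [p+m]CJ≈[mCJ]+[mC[J∸p]] m J p≤J = trans (vandermonde p m J) (Σ≤-[pCi] J (λ i → [ m C (J ℕ.∸ i) ]) p≤J)

    lucas : ∀ N a {r} → r < p → [ (N ℕ.* p ℕ.+ r) C (a ℕ.* p) ] ≈ [ N C a ]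
    lucas zero    zero    r<p = refl
    lucas zero    (suc a) r<p = reflexive (≡.cong [_] (k>n⇒nCk≡0 (ℕ.<-≤-trans r<p (ℕ.m≤m+n p (a ℕ.* p)))))
    lucas (suc N) zero    r<p = refl
    lucas (suc N) (suc a) {r} r<p = begin
      [ (p ℕ.+ N ℕ.* p ℕ.+ r) C (p ℕ.+ A) ]         ≡⟨ ≡.cong (λ n → [ n C (p ℕ.+ A) ]) (ℕ.+-assoc p (N ℕ.* p) r) ⟩
      [ (p ℕ.+ M) C (p ℕ.+ A) ]                     ≈⟨ [p+m]CJ≈[mCJ]+[mC[J∸p]] M (p ℕ.+ A) (ℕ.m≤m+n p A) ⟩
      [ M C (p ℕ.+ A) ] + [ M C (p ℕ.+ A ℕ.∸ p) ]   ≡⟨ ≡.cong (λ j → [ M C (p ℕ.+ A) ] + [ M C j ]) (ℕ.m+n∸m≡n p A) ⟩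
      [ M C (p ℕ.+ A) ] + [ M C A ]                 ≈⟨ +-cong (lucas N (suc a) r<p) (lucas N a r<p) ⟩
      [ N C suc a ] + [ N C a ]                     ≈⟨ +-comm _ _ ⟩
      [ N C a ] + [ N C suc a ]                     ≈⟨ [m+n]≈[m]+[n] (N C a) (N C suc a) ⟨
      [ N C a ℕ.+ N C suc a ]                       ≡⟨ ≡.cong [_] (pascal N a) ⟨
      [ suc N C suc a ]                             ∎
      where
      M A : ℕ
      M = N ℕ.* p ℕ.+ r
      A = a ℕ.* p

    [n]≉0 : ¬ 0# ≈ 1# → ∀ {n} → ¬ p ∣ n → ¬ [ n ] ≈ 0#
    [n]≉0 0≉1 {n} p∤n [n]≈0 with coprime-Bézout coprime
      where
      coprime : Coprime p n
      coprime (d∣p , d∣n) with prime⇒irreducible p-prime d∣p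
      ... | inj₁ d≡1    = d≡1
      ... | inj₂ ≡.refl = ⊥-elim (p∤n d∣n)
    ... | GCD.Bézout.+- x y 1+yn≡xp = 0≉1 (begin
      0#                ≈⟨ [m]≈0⇒[k*m]≈0 p [p]≈0 x ⟨
      [ x ℕ.* p ]       ≡⟨ ≡.cong [_] 1+yn≡xp ⟨
      [ suc (y ℕ.* n) ] ≈⟨ [m]≈0⇒[1+k*m]≈1 n [n]≈0 y ⟩
      1#                ∎)
    ... | GCD.Bézout.-+ x y 1+xp≡yn = 0≉1 (begin
      0#                ≈⟨ [m]≈0⇒[k*m]≈0 n [n]≈0 y ⟨
      [ y ℕ.* n ]       ≡⟨ ≡.cong [_] 1+xp≡yn ⟨
      [ suc (x ℕ.* p) ] ≈⟨ [m]≈0⇒[1+k*m]≈1 p [p]≈0 x ⟩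
      1#                ∎)

module OddCharacteristic {a ℓ} (F : CommutativeRing a ℓ) (isField : IsField F) {p} (p-prime : Prime p)
                         {r} (p≡1+2r : p ≡ suc (r ℕ.+ r)) where

  open CommutativeRing F
  open RingLemmas F
  open FieldLemmas F
  open CharacteristicLemmas F p-prime
  open import Data.Nat.Base using (zero; _≤_; _<_; s≤s)
  import Data.Nat.Properties as ℕ
  open import Data.Nat.Combinatorics using (_C_)
  open import Data.Nat.Divisibility using (divides; _∣?_)
  open import Data.Nat.Tactic.RingSolver using (solve-∀)
  open import Data.Integer.Base using (+_)
  open import Algebra.Definitions.RawSemiring (Semiring.rawSemiring semiring) using () renaming (_×_ to _·ₙ_)
  open import Algebra.Properties.Semiring.Exp semiring using (_^_; ^-assocʳ; ^-congˡ)
  open import Algebra.Properties.CommutativeSemiring.Exp commutativeSemiring using (^-distrib-*)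
  open import Algebra.Properties.Group +-group using (x∙y⁻¹≈ε⇒x≈y)
  open import Algebra.Properties.Ring ring using (-0#≈0#)
  import Algebra.Properties.CommutativeSemigroup *-commutativeSemigroup as CS*
  open import Relation.Binary.Reasoning.Setoid setoid

  -- half n = (p^n - 1)/2, whose base-p digits all equal r.
  half : ℕ → ℕ
  half zero    = 0
  half (suc n) = half n ℕ.* p ℕ.+ r

  1+2*half≡p^n : ∀ n → suc (half n ℕ.+ half n) ≡ p ℕ.^ n
  1+2*half≡p^n zero    = ≡.refl
  1+2*half≡p^n (suc n) =
    ≡.trans (≡.cong (λ q → suc (half n ℕ.* q ℕ.+ r ℕ.+ (half n ℕ.* q ℕ.+ r))) p≡1+2r)
    (≡.trans (factorise (half n) r) (≡.cong₂ ℕ._*_ (≡.sym p≡1+2r) (1+2*half≡p^n n)))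
    where
    factorise : ∀ h r → suc (h ℕ.* suc (r ℕ.+ r) ℕ.+ r ℕ.+ (h ℕ.* suc (r ℕ.+ r) ℕ.+ r)) ≡ suc (r ℕ.+ r) ℕ.* suc (h ℕ.+ h)
    factorise = solve-∀

  r<p : r < p
  r<p = ≡.subst (r <_) (≡.sym p≡1+2r) (s≤s (ℕ.m≤m+n r r))

  module _ ([p]≈0 : [ p ] ≈ 0#) where

    [1+2*half[1+n]]≈0 : ∀ n → [ suc (half (suc n) ℕ.+ half (suc n)) ] ≈ 0#
    [1+2*half[1+n]]≈0 n = trans (reflexive (≡.cong [_] (≡.trans (1+2*half≡p^n (suc n)) (ℕ.*-comm p (p ℕ.^ n)))))
                                  ([m]≈0⇒[k*m]≈0 p [p]≈0 (p ℕ.^ n))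

    module _ {t} (t+4≈0 : t + [ 4 ] ≈ 0#) (t^p≈t : t ^ p ≈ t) where

      t*[[m]-[k]]≈[2*[1+2k]] : ∀ m k → [ suc (m ℕ.+ m) ] ≈ 0# → t * ([ m ] - [ k ]) ≈ [ 2 ℕ.* suc (k ℕ.+ k) ]
      t*[[m]-[k]]≈[2*[1+2k]] m k [1+2m]≈0 = begin
        t * ([ m ] - [ k ])
          ≈⟨ regroup t [ m ] [ k ] ⟩
        (t + [ 4 ]) * ([ m ] - [ k ]) - [ 2 ] * (1# + ([ m ] + [ m ])) + [ 2 ] * (1# + ([ k ] + [ k ]))
          ≈⟨ +-congʳ (+-cong (trans (*-congʳ t+4≈0) (zeroˡ _)) (-‿cong (trans (*-congˡ 1+2m≈0) (zeroʳ [ 2 ])))) ⟩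
        0# - 0# + [ 2 ] * (1# + ([ k ] + [ k ]))
          ≈⟨ trans (+-congʳ (-‿inverseʳ 0#)) (+-identityˡ _) ⟩
        [ 2 ] * (1# + ([ k ] + [ k ]))
          ≈⟨ *-congˡ (+-congˡ ([m+n]≈[m]+[n] k k)) ⟨
        [ 2 ] * [ suc (k ℕ.+ k) ]
          ≈⟨ [m*n]≈[m]*[n] 2 (suc (k ℕ.+ k)) ⟨
        [ 2 ℕ.* suc (k ℕ.+ k) ] ∎
        where
        1+2m≈0 : 1# + ([ m ] + [ m ]) ≈ 0#
        1+2m≈0 = trans (+-congˡ (sym ([m+n]≈[m]+[n] m m))) [1+2m]≈0
        regroup : ∀ t m k → t * (m - k) ≈ (t + [ 4 ]) * (m - k) - [ 2 ] * (1# + (m + m)) + [ 2 ] * (1# + (k + k))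
        regroup t m k = solve 4 (λ t m k o →
          t :* (m :- k) := (t :+ con (+ 4)) :* (m :- k) :- con (+ 2) :* (o :+ (m :+ m)) :+ con (+ 2) :* (o :+ (k :+ k)))
          refl t m k 1#

      scaled-recurrence : ∀ m k → [ suc (m ℕ.+ m) ] ≈ 0# →
                          [ suc k ] * (t ^ suc k * [ m C suc k ]) ≈ [ 2 ℕ.* suc (k ℕ.+ k) ] * (t ^ k * [ m C k ])
      scaled-recurrence m k [1+2m]≈0 = begin
        [ suc k ] * (t * t ^ k * [ m C suc k ])
          ≈⟨ solve 4 (λ a t u b → a :* (t :* u :* b) := u :* (t :* (a :* b))) refl [ suc k ] t (t ^ k) [ m C suc k ] ⟩
        t ^ k * (t * ([ suc k ] * [ m C suc k ]))
          ≈⟨ *-congˡ (*-congˡ ([1+k]*[mC[1+k]]≈[[m]-[k]]*[mCk] m k)) ⟩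
        t ^ k * (t * (([ m ] - [ k ]) * [ m C k ]))
          ≈⟨ *-congˡ (*-assoc t _ _) ⟨
        t ^ k * (t * ([ m ] - [ k ]) * [ m C k ])
          ≈⟨ *-congˡ (*-congʳ (t*[[m]-[k]]≈[2*[1+2k]] m k [1+2m]≈0)) ⟩
        t ^ k * ([ 2 ℕ.* suc (k ℕ.+ k) ] * [ m C k ])
          ≈⟨ CS*.x∙yz≈y∙xz (t ^ k) _ _ ⟩
        [ 2 ℕ.* suc (k ℕ.+ k) ] * (t ^ k * [ m C k ]) ∎

      t^[a*p]≈t^a : ∀ a → t ^ (a ℕ.* p) ≈ t ^ a
      t^[a*p]≈t^a a = trans (reflexive (≡.cong (t ^_) (ℕ.*-comm a p))) (trans (sym (^-assocʳ t p a)) (^-congˡ a t^p≈t))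

      central-binomial≈ : ∀ n k → k ≤ half n → [ (k ℕ.+ k) C k ] ≈ t ^ k * [ half n C k ]
      central-binomial≈ zero    zero _ = sym (*-identityˡ _)
      central-binomial≈ (suc n) = go
        where
        m : ℕ
        m = half (suc n)
        go : ∀ k → k ≤ m → [ (k ℕ.+ k) C k ] ≈ t ^ k * [ m C k ]
        go zero    _ = sym (*-identityˡ _)
        go (suc k) 1+k≤m with p ∣? suc k
        ... | no p∤1+k = *-cancelˡ isField ([n]≉0 [p]≈0 (proj₁ isField) p∤1+k) (begin
          [ suc k ] * [ (suc k ℕ.+ suc k) C suc k ]        ≈⟨ central-recurrence k ⟩
          [ 2 ℕ.* suc (k ℕ.+ k) ] * [ (k ℕ.+ k) C k ]      ≈⟨ *-congˡ (go k (ℕ.≤-trans (ℕ.n≤1+n k) 1+k≤m)) ⟩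
          [ 2 ℕ.* suc (k ℕ.+ k) ] * (t ^ k * [ m C k ])    ≈⟨ scaled-recurrence m k ([1+2*half[1+n]]≈0 n) ⟨
          [ suc k ] * (t ^ suc k * [ m C suc k ])          ∎)
        ... | yes (divides a 1+k≡a*p) = begin
          [ (suc k ℕ.+ suc k) C suc k ]
            ≡⟨ ≡.cong (λ j → [ (j ℕ.+ j) C j ]) 1+k≡a*p ⟩
          [ (a ℕ.* p ℕ.+ a ℕ.* p) C (a ℕ.* p) ]
            ≡⟨ ≡.cong (λ j → [ j C (a ℕ.* p) ]) (≡.trans (≡.sym (ℕ.*-distribʳ-+ p a a)) (≡.sym (ℕ.+-identityʳ _))) ⟩
          [ ((a ℕ.+ a) ℕ.* p ℕ.+ 0) C (a ℕ.* p) ]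
            ≈⟨ lucas [p]≈0 (a ℕ.+ a) a 0<p ⟩
          [ (a ℕ.+ a) C a ]
            ≈⟨ central-binomial≈ n a (a*p≤h*p+r⇒a≤h r<p (≡.subst (_≤ m) 1+k≡a*p 1+k≤m)) ⟩
          t ^ a * [ half n C a ]
            ≈⟨ *-cong (t^[a*p]≈t^a a) (lucas [p]≈0 (half n) a r<p) ⟨
          t ^ (a ℕ.* p) * [ m C (a ℕ.* p) ]
            ≡⟨ ≡.cong (λ j → t ^ j * [ m C j ]) 1+k≡a*p ⟨
          t ^ suc k * [ m C suc k ] ∎

    [4*[r+r]]+[4]≈0 : [ 4 ℕ.* (r ℕ.+ r) ] + [ 4 ] ≈ 0#
    [4*[r+r]]+[4]≈0 = begin
      [ 4 ℕ.* (r ℕ.+ r) ] + [ 4 ]     ≈⟨ [m+n]≈[m]+[n] (4 ℕ.* (r ℕ.+ r)) 4 ⟨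
      [ 4 ℕ.* (r ℕ.+ r) ℕ.+ 4 ]       ≡⟨ ≡.cong [_] (≡.trans (ℕ.+-comm (4 ℕ.* (r ℕ.+ r)) 4) (≡.sym (ℕ.*-suc 4 (r ℕ.+ r)))) ⟩
      [ 4 ℕ.* suc (r ℕ.+ r) ]         ≡⟨ ≡.cong (λ q → [ 4 ℕ.* q ]) p≡1+2r ⟨
      [ 4 ℕ.* p ]                     ≈⟨ [m]≈0⇒[k*m]≈0 p [p]≈0 4 ⟩
      0#                              ∎

    -- The natural number 4 (r + r) = 4 (p - 1) stands for -4: being the image of a natural number,
    -- it is fixed by frobenius.
    [k*2kCk]*[-z]^k≈[k*mCk]*[4z]^k : ∀ n z k → k ≤ half n →
                                     [ k ℕ.* ((k ℕ.+ k) C k) ] * (- z) ^ k ≈ [ k ℕ.* (half n C k) ] * (4 ·ₙ z) ^ k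
    [k*2kCk]*[-z]^k≈[k*mCk]*[4z]^k n z k k≤m = begin
      [ k ℕ.* ((k ℕ.+ k) C k) ] * (- z) ^ k
        ≈⟨ *-congʳ ([m*n]≈[m]*[n] k ((k ℕ.+ k) C k)) ⟩
      [ k ] * [ (k ℕ.+ k) C k ] * (- z) ^ k
        ≈⟨ *-congʳ (*-congˡ (central-binomial≈ [4*[r+r]]+[4]≈0 (frobenius [p]≈0 (4 ℕ.* (r ℕ.+ r))) n k k≤m)) ⟩
      [ k ] * (t ^ k * [ m C k ]) * (- z) ^ k
        ≈⟨ solve 4 (λ a b c d → a :* (b :* c) :* d := a :* c :* (b :* d)) refl [ k ] (t ^ k) [ m C k ] ((- z) ^ k) ⟩
      [ k ] * [ m C k ] * (t ^ k * (- z) ^ k)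
        ≈⟨ *-cong (sym ([m*n]≈[m]*[n] k (m C k))) (sym (^-distrib-* t (- z) k)) ⟩
      [ k ℕ.* (m C k) ] * (t * - z) ^ k
        ≈⟨ *-congˡ (^-congˡ k t*-z≈4z) ⟩
      [ k ℕ.* (m C k) ] * (4 ·ₙ z) ^ k ∎
      where
      m : ℕ
      m = half n
      t : Carrier
      t = [ 4 ℕ.* (r ℕ.+ r) ]
      t*-z≈4z : t * - z ≈ 4 ·ₙ z
      t*-z≈4z = begin
        t * - z                        ≈⟨ solve 3 (λ t f z → t :* (:- z) := f :* z :- (t :+ f) :* z) refl t [ 4 ] z ⟩
        [ 4 ] * z - (t + [ 4 ]) * z    ≈⟨ +-congˡ (-‿cong (trans (*-congʳ [4*[r+r]]+[4]≈0) (zeroˡ z))) ⟩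
        [ 4 ] * z - 0#                 ≈⟨ trans (+-congˡ -0#≈0#) (+-identityʳ _) ⟩
        [ 4 ] * z                      ≈⟨ ·ₙ≈[]* 4 z ⟨
        4 ·ₙ z                         ∎

    [1+4z]^half≈1 : ∀ n → HasCardinality F (p ℕ.^ suc n) → ∀ {z α β} → ¬ α ≈ β →
                    α * α + α - z ≈ 0# → β * β + β - z ≈ 0# → (1# + 4 ·ₙ z) ^ half (suc n) ≈ 1#
    [1+4z]^half≈1 n card {z} {α} {β} α≉β α-root β-root = begin
      (1# + 4 ·ₙ z) ^ half (suc n)        ≈⟨ ^-congˡ (half (suc n)) (discriminant isField α≉β α-root β-root) ⟨
      ((α - β) * (α - β)) ^ half (suc n)  ≈⟨ square^half≈1 isField {half (suc n)} card′ (α≉β ∘ x∙y⁻¹≈ε⇒x≈y α β) ⟩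
      1#                                  ∎
      where
      card′ : HasCardinality F (suc (half (suc n) ℕ.+ half (suc n)))
      card′ = ≡.subst (HasCardinality F) (≡.sym (1+2*half≡p^n (suc n))) card

    Σ≤-summand≈2zw : ∀ n → HasCardinality F (p ℕ.^ suc n) → ∀ {z w α β} → ¬ α ≈ β →
                     α * α + α - z ≈ 0# → β * β + β - z ≈ 0# → (1# + 4 ·ₙ z) * w ≈ 1# →
                     Σ≤ ((p ℕ.^ suc n ℕ.∸ 1) ℕ./ 2) (summand z) ≈ 2 ·ₙ z * w
    Σ≤-summand≈2zw n card {z} {w} α≉β α-root β-root [1+y]w≈1 = begin
      Σ≤ ((p ℕ.^ suc n ℕ.∸ 1) ℕ./ 2) (summand z)     ≡⟨ ≡.cong (λ m → Σ≤ m (summand z)) [q-1]/2≡M ⟩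
      Σ≤ M (summand z)                                ≈⟨ Σ≤-summand M z ⟩
      - Σ≤ M (λ k → [ k ℕ.* ((k ℕ.+ k) C k) ] * (- z) ^ k)
        ≈⟨ -‿cong (Σ≤-cong M ([k*2kCk]*[-z]^k≈[k*mCk]*[4z]^k (suc n) z)) ⟩
      - S                                             ≈⟨ -‿cong (trans (sym (*-identityʳ S)) (*-congˡ (sym [1+y]w≈1))) ⟩
      - (S * ((1# + y) * w))                          ≈⟨ -‿cong (*-assoc S (1# + y) w) ⟨
      - (S * (1# + y) * w)                            ≈⟨ -‿cong (*-congʳ (Σ≤-k*mCk*[1+y] M y)) ⟩
      - ([ M ] * y * (1# + y) ^ M * w)                ≈⟨ -‿cong (*-congʳ (trans (*-congˡ [1+y]^M≈1) (*-identityʳ _))) ⟩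
      - ([ M ] * y * w)                               ≈⟨ -‿cong (*-congʳ (*-congˡ (·ₙ≈[]* 4 z))) ⟩
      - ([ M ] * ([ 4 ] * z) * w)                     ≈⟨ regroup [ M ] z w ⟩
      [ 2 ] * z * w - [ 2 ] * z * w * ([ 1 ] + ([ M ] + [ M ]))
        ≈⟨ +-congˡ (-‿cong (trans (*-congˡ [1+2M]≈0) (zeroʳ _))) ⟩
      [ 2 ] * z * w - 0#                              ≈⟨ trans (+-congˡ -0#≈0#) (+-identityʳ _) ⟩
      [ 2 ] * z * w                                   ≈⟨ *-congʳ (·ₙ≈[]* 2 z) ⟨
      2 ·ₙ z * w                                      ∎
      where
      M : ℕ
      M = half (suc n)
      y S : Carrier
      y = 4 ·ₙ z
      S = Σ≤ M (λ k → [ k ℕ.* (M C k) ] * y ^ k)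
      [q-1]/2≡M : (p ℕ.^ suc n ℕ.∸ 1) ℕ./ 2 ≡ M
      [q-1]/2≡M = ≡.trans (≡.cong (λ q → (q ℕ.∸ 1) ℕ./ 2) (≡.sym (1+2*half≡p^n (suc n)))) ([1+2m∸1]/2≡m M)
      [1+y]^M≈1 : (1# + y) ^ M ≈ 1#
      [1+y]^M≈1 = [1+4z]^half≈1 n card α≉β α-root β-root
      [1+2M]≈0 : [ 1 ] + ([ M ] + [ M ]) ≈ 0#
      [1+2M]≈0 = trans (+-congˡ (sym ([m+n]≈[m]+[n] M M))) (trans (sym ([m+n]≈[m]+[n] 1 (M ℕ.+ M))) ([1+2*half[1+n]]≈0 n))
      regroup : ∀ m z w → - (m * ([ 4 ] * z) * w) ≈ [ 2 ] * z * w - [ 2 ] * z * w * ([ 1 ] + (m + m))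
      regroup = solve 3 (λ m z w →
        :- (m :* (con (+ 4) :* z) :* w) := con (+ 2) :* z :* w :- con (+ 2) :* z :* w :* (con (+ 1) :+ (m :+ m))) refl

open import Data.Integer as ℤ using (ℤ; +_)
open Defs using (_^_; _·ₙ_)

lemma5p3 : ∀ {c ℓ} (F : CommutativeRing c ℓ) →
    let open CommutativeRing F in
    IsField F →
    (p q : ℕ) → Prime p → (∃ λ n → n ≥ 1 × q ≡ p ℕ.^ n) →
    HasCardinality F q → _·ₙ_ F p 1# ≈ 0# →
    (z : Carrier) → ¬ (z ≈ 0#) →
    (∃₂ λ r s → ¬ (r ≈ s) × (r * r + r) - z ≈ 0# × (s * s + s) - z ≈ 0#) →
    (w : Carrier) → (1# + _·ₙ_ F 4 z) * w ≈ 1# →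
    sumTo F ((q ℕ.∸ 1) ℕ./ 2)
      (λ k → (ι F (+ suc k) * ι F (binomℤ (ℤ.- (+ k)) (suc k))) * _^_ F z k)
      ≈ _·ₙ_ F 2 z * w
lemma5p3 F isField p _ p-prime (suc n , _ , ≡.refl) card [p]≈0 z _ (α , β , α≉β , α-root , β-root) w [1+4z]w≈1
  with prime⇒≡2⊎odd p-prime
... | inj₁ ≡.refl       = RingLemmas.[2]≈0⇒Σ≤-summand≈2zw F [p]≈0 ((2 ℕ.^ suc n ℕ.∸ 1) ℕ./ 2) z w
... | inj₂ (r , p≡1+2r) =
  OddCharacteristic.Σ≤-summand≈2zw F isField p-prime {r} p≡1+2r [p]≈0 n card α≉β α-root β-root [1+4z]w≈1
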